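{- For all integers $1 \le k \le n$, let $lt_{\alpha}$ denote the number of standard lexical tableaux of shape $\alpha$. Then \[ \sum_{\substack{ \alpha \vDash n,\\ \ell(\alpha)=k}} lt_{\alpha} = {n \brack k}, \] where ${n \brack k}$ is the unsigned Stirling number of the first kind, i.e. the number of permutations of $\{1,\dots,n\}$ having exactly $k$ disjoint cycles.
   Context: A composition $\alpha \vDash n$ is a finite tuple of positive integers $(\alpha_1,\dots,\alpha_{\ell(\alpha)})$ summing to $n$. Its diagram has left-justified rows, row $i$ (counted from the bottom) having $\alpha_i$ cells. For a word $w=w_1\cdots w_m$ over a totally ordered alphabet, its cyclic shifts are $w_{i+1}\cdots w_m w_1\cdots w_i$ for $i\in\{1,\dots,m\}$; $w$ is a necklace word if it is lexicographically smallest (weakly) among all its cyclic shifts. A lexical tableau of shape $\alpha$ and type (content) $\beta$ is a filling of the diagram of $\alpha$ with positive integers such that the integer $i$ appears exactly $\beta_i$ times, the entries of the first column strictly increase from row $1$ upward, and for each $i$ the word formed by the entries of row $i$ read left to right is a necklace word. A lexical tableau is standard if its type is $(1,1,\dots,1)=(1^n)$, i.e. it uses each of $1,\dots,n$ exactly once. -}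

module Defs where

open import Data.Nat using (ℕ; zero; suc; _≤_; _<_)
open import Data.Nat.ListAction using (sum)
open import Data.List using (List; []; _∷_; map; length; concat; upTo; drop; take; _++_)
open import Data.List.Relation.Unary.All using (All)
open import Data.List.Relation.Unary.Linked using (Linked)
open import Data.List.Relation.Unary.Unique.Propositional using (Unique)
open import Data.List.Membership.Propositional using (_∈_)
open import Data.List.Relation.Binary.Permutation.Propositional using (_↭_)
open import Data.Product using (Σ; _×_)
open import Data.Sum using (_⊎_)
open import Data.Unit using (⊤)
open import Relation.Binary.PropositionalEquality using (_≡_)

IsCount : {A : Set} → (A → Set) → ℕ → Set
IsCount {A} P m =
  Σ (List A) λ L → Unique L × length L ≡ m × (∀ x → (x ∈ L → P x) × (P x → x ∈ L))

IsComposition : ℕ → List ℕ → Set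
IsComposition n α = All (λ a → 1 ≤ a) α × sum α ≡ n

data _≤lex_ : List ℕ → List ℕ → Set where
  []≤   : ∀ {w} → [] ≤lex w
  here  : ∀ {x y xs ys} → x < y → (x ∷ xs) ≤lex (y ∷ ys)
  there : ∀ {x xs ys} → xs ≤lex ys → (x ∷ xs) ≤lex (x ∷ ys)

cyclicShift : ℕ → List ℕ → List ℕ
cyclicShift i w = drop i w ++ take i w

IsNecklace : List ℕ → Set
IsNecklace w = ∀ i → 1 ≤ i → i ≤ length w → w ≤lex cyclicShift i w

-- Fillings of the diagram of α: a list of rows, row 1 (bottom) first,
-- each row read left to right.

firstColumn : List (List ℕ) → List ℕ
firstColumn []             = []
firstColumn ([] ∷ rs)      = firstColumn rs
firstColumn ((x ∷ _) ∷ rs) = x ∷ firstColumn rs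

oneTo : ℕ → List ℕ
oneTo n = map suc (upTo n)

IsStdLexTableau : ℕ → List ℕ → List (List ℕ) → Set
IsStdLexTableau n α T =
  map length T ≡ α
  × concat T ↭ oneTo n
  × Linked _<_ (firstColumn T)
  × All IsNecklace T

-- Permutations of {1,…,n}, in one-line notation σ = σ(1) ⋯ σ(n).

IsPermutation : ℕ → List ℕ → Set
IsPermutation n σ = σ ↭ oneTo n

-- σ(i) for 1 ≤ i ≤ length σ (junk value 0 otherwise)
apply : List ℕ → ℕ → ℕ
apply []       _             = 0
apply (x ∷ _)  zero          = 0
apply (x ∷ _)  (suc zero)    = x
apply (_ ∷ xs) (suc (suc i)) = apply xs (suc i)

iter : (ℕ → ℕ) → ℕ → ℕ → ℕ
iter f zero    x = x
iter f (suc m) x = f (iter f m x)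

IsCycleMin : ℕ → List ℕ → ℕ → Set
IsCycleMin n σ i = 1 ≤ i × i ≤ n × (∀ m → i ≤ iter (apply σ) m i)

-- σ has exactly k disjoint cycles (each cycle has exactly one minimum)
HasCycles : ℕ → List ℕ → ℕ → Set
HasCycles n σ k = IsCount (IsCycleMin n σ) k

module Submission where

-- Read each row of a standard lexical tableau as a cycle (x₁ x₂ … xₘ); this gives a
-- permutation of {1,…,n} whose cycles are exactly the rows. As the entries are distinct,
-- a row is a necklace iff it starts with its least entry, and the strictly increasing
-- first column orders the rows by these minima. Conversely, writing each cycle of a
-- permutation from its least element and listing the cycles by increasing minima gives
-- such a tableau. The two constructions are inverse, and ℓ(α) is the number of cycles.

open import Defs
open import Data.Empty using (⊥-elim)
open import Data.List using (List; []; _∷_; _++_; _∷ʳ_; length; map; concat; upTo; applyUpTo; filter; zip; drop; take)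
open import Data.List.Extrema.Nat using (min; min≤⊤; min≤xs; argmin-all)
open import Data.Nat using (ℕ; zero; suc; _+_; _∸_; _≤_; _<_; z≤n; s≤s; _≟_)
open import Data.List.Membership.DecPropositional _≟_ using (_∈?_)
open import Data.List.Membership.Propositional using (_∈_)
open import Data.List.Membership.Propositional.Properties
  using (∈-map⁺; ∈-map⁻; ∈-++⁺ˡ; ∈-++⁺ʳ; ∈-++⁻; ∈-∃++; ∈-concat⁺′; ∈-concat⁻′;
         ∈-applyUpTo⁺; ∈-applyUpTo⁻; ∈-upTo⁺; ∈-upTo⁻; ∈-filter⁺; ∈-filter⁻)
open import Data.List.Membership.Propositional.Properties.WithK using (unique∧set⇒bag)
open import Data.List.Properties
  using (∷-injective; ∷-injectiveʳ; ∷ʳ-injectiveʳ; length-++; length-map; length-applyUpTo; length-filter;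
         map-++; map-∘; map-cong; map-cong-local; map-upTo; map-applyUpTo; applyUpTo-∷ʳ;
         concat-map; drop-all; take-all)
open import Data.List.Relation.Binary.BagAndSetEquality using (∼bag⇒↭)
open import Data.List.Relation.Binary.Disjoint.Propositional using (Disjoint)
open import Data.List.Relation.Binary.Permutation.Propositional
  using (_↭_; ↭-refl; ↭-sym; ↭⇒↭ₛ; module PermutationReasoning)
open import Data.List.Relation.Binary.Permutation.Propositional.Properties
  using (∈-resp-↭; ↭-length; ∷↭∷ʳ; ++⁺)
import Data.List.Relation.Binary.Permutation.Propositional.Properties as ↭
import Data.List.Relation.Binary.Permutation.Setoid.Properties as ↭ₛ
open import Data.List.Relation.Binary.Pointwise using (Pointwise-≡⇒≡)
open import Data.List.Relation.Unary.All as All using (All; []; _∷_)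
import Data.List.Relation.Unary.All.Properties as All
open import Data.List.Relation.Unary.AllPairs as AllPairs using (AllPairs; []; _∷_)
import Data.List.Relation.Unary.AllPairs.Properties as AllPairs
open import Data.List.Relation.Unary.Any using (here; there)
open import Data.List.Relation.Unary.Linked as Linked using (Linked)
import Data.List.Relation.Unary.Linked.Properties as Linked
open import Data.List.Relation.Unary.Sorted.TotalOrder.Properties using (↗↭↗⇒≋)
open import Data.List.Relation.Unary.Unique.Propositional using (Unique)
import Data.List.Relation.Unary.Unique.Propositional.Properties as Unique
open import Data.Nat.ListAction using (sum)
open import Data.Nat.Properties
open import Data.Product using (∃; ∃₂; _×_; _,_; proj₁; proj₂)
open import Data.Sum using (inj₁; inj₂)
open import Function using (_∘_)
open import Function.Bundles using (mk⇔)
open import Relation.Binary.PropositionalEquality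
  using (_≡_; refl; sym; trans; cong; cong₂; subst; subst₂; setoid; module ≡-Reasoning)
open import Relation.Nullary using (¬_; yes; no)
open import Relation.Unary using (Decidable)

module _ {A : Set} where

  unique∧set⇒↭ : {xs ys : List A} → Unique xs → Unique ys →
                 (∀ {x} → x ∈ xs → x ∈ ys) → (∀ {x} → x ∈ ys → x ∈ xs) → xs ↭ ys
  unique∧set⇒↭ u v xs⊆ys ys⊆xs = ∼bag⇒↭ (unique∧set⇒bag u v (mk⇔ xs⊆ys ys⊆xs))

  Unique-resp-↭ : {xs ys : List A} → xs ↭ ys → Unique xs → Unique ys
  Unique-resp-↭ p = ↭ₛ.Unique-resp-↭ (setoid A) (↭⇒↭ₛ p)

  Unique-++⁻ : ∀ xs {ys : List A} → Unique (xs ++ ys) → Unique xs × Unique ys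
  Unique-++⁻ []       u          = [] , u
  Unique-++⁻ (x ∷ xs) (x∉ ∷ u) =
    All.++⁻ˡ xs x∉ ∷ proj₁ (Unique-++⁻ xs u) , proj₂ (Unique-++⁻ xs u)

  Unique-concat⁻ : ∀ {xs} xss → Unique (concat xss) → xs ∈ xss → Unique {A = A} xs
  Unique-concat⁻ (xs ∷ xss) u (here refl) = proj₁ (Unique-++⁻ xs u)
  Unique-concat⁻ (ys ∷ xss) u (there xs∈) = Unique-concat⁻ xss (proj₂ (Unique-++⁻ ys u)) xs∈

  Unique-map⁺-∈ : {B : Set} {f : A → B} {xs : List A} →
                  (∀ {x y} → x ∈ xs → y ∈ xs → f x ≡ f y → x ≡ y) → Unique xs → Unique (map f xs)
  Unique-map⁺-∈ inj []         = []
  Unique-map⁺-∈ inj (x∉ ∷ u) =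
    All.map⁺ (All.tabulate λ y∈ fx≡fy → All.lookup x∉ y∈ (inj (here refl) (there y∈) fx≡fy))
    ∷ Unique-map⁺-∈ (λ x∈ y∈ → inj (there x∈) (there y∈)) u

  AllPairs-map-All : {P : A → Set} {R S : A → A → Set} {xs : List A} →
                     (∀ {x y} → P x → P y → R x y → S x y) → All P xs → AllPairs R xs → AllPairs S xs
  AllPairs-map-All f []         []         = []
  AllPairs-map-All f (px ∷ pxs) (rx ∷ rxs) =
    All.zipWith (λ (py , r) → f px py r) (pxs , rx) ∷ AllPairs-map-All f pxs rxs

  map-≡⇒≡-∈ : {B : Set} {f g : A → B} {xs : List A} → map f xs ≡ map g xs → ∀ {x} → x ∈ xs → f x ≡ g x
  map-≡⇒≡-∈ {xs = _ ∷ _} e (here refl) = proj₁ (∷-injective e)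
  map-≡⇒≡-∈ {xs = _ ∷ _} e (there x∈) = map-≡⇒≡-∈ (∷-injectiveʳ e) x∈

  applyUpTo-cong : {f f′ : ℕ → A} → (∀ i → f i ≡ f′ i) → ∀ L → applyUpTo f L ≡ applyUpTo f′ L
  applyUpTo-cong {f} {f′} f≗f′ L =
    trans (sym (map-upTo f L)) (trans (map-cong f≗f′ (upTo L)) (map-upTo f′ L))

  applyUpTo-injective : ∀ (f : ℕ → A) {L i j} → Unique (applyUpTo f L) → i < L → j < L → f i ≡ f j → i ≡ j
  applyUpTo-injective f {suc L} {zero}  {zero}  _          _         _         _ = refl
  applyUpTo-injective f {suc L} {zero}  {suc j} (f0∉ ∷ _) _         (s≤s j<L) e =
    ⊥-elim (All.lookup f0∉ (∈-applyUpTo⁺ (f ∘ suc) j<L) e)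
  applyUpTo-injective f {suc L} {suc i} {zero}  (f0∉ ∷ _) (s≤s i<L) _         e =
    ⊥-elim (All.lookup f0∉ (∈-applyUpTo⁺ (f ∘ suc) i<L) (sym e))
  applyUpTo-injective f {suc L} {suc i} {suc j} (_ ∷ u)    (s≤s i<L) (s≤s j<L) e =
    cong suc (applyUpTo-injective (f ∘ suc) u i<L j<L e)

  map-proj-zip : {B : Set} (xs : List A) (ys : List B) → length xs ≡ length ys →
                 map proj₁ (zip xs ys) ≡ xs × map proj₂ (zip xs ys) ≡ ys
  map-proj-zip []       []       _ = refl , refl
  map-proj-zip (x ∷ xs) (y ∷ ys) e =
    cong (x ∷_) (proj₁ (map-proj-zip xs ys (suc-injective e))) ,
    cong (y ∷_) (proj₂ (map-proj-zip xs ys (suc-injective e)))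

  drop-length-++ : (xs ys : List A) → drop (length xs) (xs ++ ys) ≡ ys
  drop-length-++ []       ys = refl
  drop-length-++ (x ∷ xs) ys = drop-length-++ xs ys

  length-concat : (xss : List (List A)) → length (concat xss) ≡ sum (map length xss)
  length-concat []         = refl
  length-concat (xs ∷ xss) = trans (length-++ xs) (cong (length xs +_) (length-concat xss))

  rotate : List A → List A
  rotate []       = []
  rotate (x ∷ xs) = xs ∷ʳ x

  rotate-↭ : ∀ xs → rotate xs ↭ xs
  rotate-↭ []       = ↭-refl
  rotate-↭ (x ∷ xs) = ↭-sym (∷↭∷ʳ x xs)

  length-rotate : ∀ xs → length (rotate xs) ≡ length xs
  length-rotate xs = ↭-length (rotate-↭ xs)

  concat-map-rotate-↭ : ∀ xss → concat (map rotate xss) ↭ concat xss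
  concat-map-rotate-↭ []         = ↭-refl
  concat-map-rotate-↭ (xs ∷ xss) = ++⁺ (rotate-↭ xs) (concat-map-rotate-↭ xss)

IsCount-⋃ : {I A : Set} {P : I → A → Set} {c : I → ℕ} (is : List I) → Unique is →
            (∀ {i j x} → P i x → P j x → i ≡ j) → (∀ i → i ∈ is → IsCount (P i) (c i)) →
            IsCount (λ x → ∃ λ i → i ∈ is × P i x) (sum (map c is))
IsCount-⋃ [] _ _ _ = [] , [] , refl , λ _ → (λ ()) , λ { (_ , () , _) }
IsCount-⋃ {P = P} (i ∷ is) (i∉ ∷ u) disj count
  with L , uL , lenL , memL ← count i (here refl)
     | R , uR , lenR , memR ← IsCount-⋃ is u disj (λ j j∈ → count j (there j∈))
  = L ++ R , Unique.++⁺ uL uR disjoint , trans (length-++ L) (cong₂ _+_ lenL lenR) ,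
    λ x → into x , from x
  where
  disjoint : Disjoint L R
  disjoint (x∈L , x∈R) with j , j∈ , Pjx ← proj₁ (memR _) x∈R =
    All.lookup i∉ j∈ (disj (proj₁ (memL _) x∈L) Pjx)
  into : ∀ x → x ∈ L ++ R → ∃ λ j → j ∈ i ∷ is × P j x
  into x x∈ with ∈-++⁻ L x∈
  ... | inj₁ x∈L = i , here refl , proj₁ (memL x) x∈L
  ... | inj₂ x∈R with j , j∈ , Pjx ← proj₁ (memR x) x∈R = j , there j∈ , Pjx
  from : ∀ x → (∃ λ j → j ∈ i ∷ is × P j x) → x ∈ L ++ R
  from x (_ , here refl , Pix) = ∈-++⁺ˡ (proj₂ (memL x) Pix)
  from x (j , there j∈ , Pjx) = ∈-++⁺ʳ L (proj₂ (memR x) (j , j∈ , Pjx))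

IsCount-image : {A B : Set} {P : A → Set} {Q : B → Set} {m : ℕ} (f : A → B) →
                (∀ {x y} → P x → P y → f x ≡ f y → x ≡ y) → (∀ {x} → P x → Q (f x)) →
                (∀ {y} → Q y → ∃ λ x → P x × f x ≡ y) → IsCount P m → IsCount Q m
IsCount-image {Q = Q} f inj sound onto (L , uL , lenL , memL) =
  map f L , Unique-map⁺-∈ (λ x∈ y∈ → inj (proj₁ (memL _) x∈) (proj₁ (memL _) y∈)) uL ,
  trans (length-map f L) lenL , λ y → into , from
  where
  into : ∀ {y} → y ∈ map f L → Q y
  into y∈ with x , x∈ , refl ← ∈-map⁻ f y∈ = sound (proj₁ (memL x) x∈)
  from : ∀ {y} → Q y → y ∈ map f L
  from Qy with x , Px , refl ← onto Qy = ∈-map⁺ f (proj₂ (memL x) Px)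

-- The range {1,…,n} and one-line notation

InRange : ℕ → ℕ → Set
InRange n x = 1 ≤ x × x ≤ n

∈-oneTo⁺ : ∀ {n x} → InRange n x → x ∈ oneTo n
∈-oneTo⁺ {x = suc i} (_ , i<n) = ∈-map⁺ suc (∈-upTo⁺ i<n)

∈-oneTo⁻ : ∀ {n x} → x ∈ oneTo n → InRange n x
∈-oneTo⁻ x∈ with i , i∈ , refl ← ∈-map⁻ suc x∈ = s≤s z≤n , ∈-upTo⁻ i∈

oneTo-unique : ∀ n → Unique (oneTo n)
oneTo-unique n = Unique.map⁺ suc-injective (Unique.upTo⁺ n)

oneTo-strictlyIncreasing : ∀ n → AllPairs _<_ (oneTo n)
oneTo-strictlyIncreasing n = AllPairs.map⁺ (AllPairs.applyUpTo⁺₁ (λ i → i) n (λ i<j _ → s≤s i<j))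

length-oneTo : ∀ n → length (oneTo n) ≡ n
length-oneTo n = trans (length-map suc (upTo n)) (length-applyUpTo (λ i → i) n)

map-oneTo : ∀ {A : Set} (f : ℕ → A) n → map f (oneTo n) ≡ applyUpTo (f ∘ suc) n
map-oneTo f n = trans (sym (map-∘ (upTo n))) (map-upTo (f ∘ suc) n)

apply-applyUpTo : ∀ f {L i} → i < L → apply (applyUpTo f L) (suc i) ≡ f i
apply-applyUpTo f {suc L} {zero}  _         = refl
apply-applyUpTo f {suc L} {suc i} (s≤s i<L) = apply-applyUpTo (f ∘ suc) i<L

applyUpTo-apply : ∀ σ → applyUpTo (apply σ ∘ suc) (length σ) ≡ σ
applyUpTo-apply []      = refl
applyUpTo-apply (x ∷ σ) = cong (x ∷_) (applyUpTo-apply σ)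

apply-map-oneTo : ∀ f {n x} → InRange n x → apply (map f (oneTo n)) x ≡ f x
apply-map-oneTo f {n} {suc i} (_ , i<n) =
  trans (cong (λ xs → apply xs (suc i)) (map-oneTo f n)) (apply-applyUpTo (f ∘ suc) i<n)

map-apply-oneTo : ∀ σ → map (apply σ) (oneTo (length σ)) ≡ σ
map-apply-oneTo σ = trans (map-oneTo (apply σ) (length σ)) (applyUpTo-apply σ)

module _ {n σ} (perm : IsPermutation n σ) where

  length-permutation : length σ ≡ n
  length-permutation = trans (↭-length perm) (length-oneTo n)

  private
    σ-unique : Unique (applyUpTo (apply σ ∘ suc) (length σ))
    σ-unique = subst Unique (sym (applyUpTo-apply σ)) (Unique-resp-↭ (↭-sym perm) (oneTo-unique n))

    below-length : ∀ {i} → suc i ≤ n → i < length σ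
    below-length = subst (_ ≤_) (sym length-permutation)

  apply-range : ∀ {x} → InRange n x → InRange n (apply σ x)
  apply-range {suc i} (_ , i<n) =
    ∈-oneTo⁻ (∈-resp-↭ perm (subst (apply σ (suc i) ∈_) (applyUpTo-apply σ)
      (∈-applyUpTo⁺ (apply σ ∘ suc) (below-length i<n))))

  apply-injective : ∀ {x y} → InRange n x → InRange n y → apply σ x ≡ apply σ y → x ≡ y
  apply-injective {suc i} {suc j} (_ , i<n) (_ , j<n) e =
    cong suc (applyUpTo-injective (apply σ ∘ suc) σ-unique (below-length i<n) (below-length j<n) e)

module _ {P : ℕ → Set} (P? : Decidable P) where

  leastBelow : ℕ → ℕ
  leastBelow zero    = zero
  leastBelow (suc v) with anyUpTo? P? v
  ... | yes _ = leastBelow v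
  ... | no  _ = v

  leastBelow-minimal : ∀ v {k} → k < leastBelow v → ¬ P k
  leastBelow-minimal (suc v) k< Pk with anyUpTo? P? v
  ... | yes _    = leastBelow-minimal v k< Pk
  ... | no  none = none (_ , k< , Pk)

  leastBelow-satisfies : ∀ {v m} → m < v → P m → P (leastBelow v)
  leastBelow-satisfies {suc v} (s≤s m≤v) Pm with anyUpTo? P? v
  ... | yes (_ , k<v , Pk) = leastBelow-satisfies k<v Pk
  ... | no none with m≤n⇒m<n∨m≡n m≤v
  ...   | inj₁ m<v  = ⊥-elim (none (_ , m<v , Pm))
  ...   | inj₂ refl = Pm

unique-⊆⇒length-≤ : {xs ys : List ℕ} → Unique xs → Unique ys → (∀ {x} → x ∈ xs → x ∈ ys) →
                    length xs ≤ length ys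
unique-⊆⇒length-≤ {xs} {ys} uxs uys xs⊆ys = begin
  length xs                   ≡⟨ ↭-length xs↭ys∩xs ⟩
  length (filter (_∈? xs) ys) ≤⟨ length-filter (_∈? xs) ys ⟩
  length ys                   ∎
  where
  open ≤-Reasoning
  xs↭ys∩xs : xs ↭ filter (_∈? xs) ys
  xs↭ys∩xs = unique∧set⇒↭ uxs (Unique.filter⁺ (_∈? xs) uys)
    (λ x∈ → ∈-filter⁺ (_∈? xs) (xs⊆ys x∈) x∈) (λ x∈ → proj₂ (∈-filter⁻ (_∈? xs) {xs = ys} x∈))

applyUpTo-collision : ∀ (f : ℕ → ℕ) L → ¬ Unique (applyUpTo f L) →
                      ∃₂ λ i j → i < j × j < L × f i ≡ f j
applyUpTo-collision f L ¬u with anyUpTo? (λ j → anyUpTo? (λ i → f i ≟ f j) j) L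
... | yes (j , j<L , i , i<j , e) = i , j , i<j , j<L , e
... | no none = ⊥-elim (¬u (Unique.applyUpTo⁺₁ f L λ i<j j<L e → none (_ , j<L , _ , i<j , e)))

-- Orbits and cycles of a map ℕ → ℕ

module _ (g : ℕ → ℕ) where

  iter-suc : ∀ m x → iter g m (g x) ≡ iter g (suc m) x
  iter-suc zero    x = refl
  iter-suc (suc m) x = cong g (iter-suc m x)

  iter-+ : ∀ a b x → iter g (a + b) x ≡ iter g a (iter g b x)
  iter-+ zero    b x = refl
  iter-+ (suc a) b x = cong g (iter-+ a b x)

  orbit : ℕ → ℕ → List ℕ
  orbit x L = applyUpTo (λ i → iter g i x) L

  orbit-suc : ∀ x L → orbit x (suc L) ≡ x ∷ orbit (g x) L
  orbit-suc x L = cong (x ∷_) (applyUpTo-cong (λ i → sym (iter-suc i x)) L)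

  IsCycleOf : List ℕ → Set
  IsCycleOf w = map g w ≡ rotate w

  -- IsCycleMin n σ h unfolds to 1 ≤ h × h ≤ n × OrbitMinimal (apply σ) h.
  OrbitMinimal : ℕ → Set
  OrbitMinimal h = ∀ m → h ≤ iter g m h

module _ {g : ℕ → ℕ} where

  orbit-isCycle : ∀ {x p} → iter g (suc p) x ≡ x → IsCycleOf g (orbit g x (suc p))
  orbit-isCycle {x} {p} e = begin
    map g (orbit g x (suc p))                                  ≡⟨ map-applyUpTo (λ i → iter g i x) g (suc p) ⟩
    applyUpTo (λ i → iter g (suc i) x) (suc p)                 ≡⟨ applyUpTo-∷ʳ (λ i → iter g (suc i) x) p ⟨
    applyUpTo (λ i → iter g (suc i) x) p ∷ʳ iter g (suc p) x   ≡⟨ cong (applyUpTo (λ i → iter g (suc i) x) p ∷ʳ_) e ⟩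
    rotate (orbit g x (suc p))                                 ∎
    where open ≡-Reasoning

  cycle≡orbit : ∀ {x t} → IsCycleOf g (x ∷ t) → x ∷ t ≡ orbit g x (suc (length t))
  cycle≡orbit = chain
    where
    open ≡-Reasoning
    -- generalised to an arbitrary last image z, so that the induction goes through
    chain : ∀ {x t z} → map g (x ∷ t) ≡ t ∷ʳ z → x ∷ t ≡ orbit g x (suc (length t))
    chain {x} {[]}    _ = refl
    chain {x} {y ∷ t} e with refl , e′ ← ∷-injective e = begin
      x ∷ g x ∷ t                          ≡⟨ cong (x ∷_) (chain e′) ⟩
      x ∷ orbit g (g x) (suc (length t))   ≡⟨ orbit-suc g x (suc (length t)) ⟨
      orbit g x (suc (suc (length t)))     ∎

  cycle-period : ∀ {x t} → IsCycleOf g (x ∷ t) → iter g (suc (length t)) x ≡ x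
  cycle-period {x} {t} c = ∷ʳ-injectiveʳ (applyUpTo (λ i → iter g (suc i) x) (length t)) t (begin
    applyUpTo (λ i → iter g (suc i) x) (length t) ∷ʳ iter g (suc (length t)) x
      ≡⟨ applyUpTo-∷ʳ (λ i → iter g (suc i) x) (length t) ⟩
    applyUpTo (λ i → iter g (suc i) x) (suc (length t))
      ≡⟨ map-applyUpTo (λ i → iter g i x) g (suc (length t)) ⟨
    map g (orbit g x (suc (length t)))
      ≡⟨ cong (map g) (cycle≡orbit c) ⟨
    map g (x ∷ t)
      ≡⟨ c ⟩
    t ∷ʳ x ∎)
    where open ≡-Reasoning

  cycle-closed : ∀ {w x} → IsCycleOf g w → x ∈ w → ∀ m → iter g m x ∈ w
  cycle-closed     c x∈ zero    = x∈
  cycle-closed {w} c x∈ (suc m) = ∈-resp-↭ (rotate-↭ w) (subst (_ ∈_) c (∈-map⁺ g (cycle-closed c x∈ m)))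

  cycle-connected : ∀ {w x y} → IsCycleOf g w → x ∈ w → y ∈ w → ∃ λ m → iter g m x ≡ y
  cycle-connected {h ∷ t} {x} {y} c x∈ y∈
    with i , i<L , refl ← ∈-applyUpTo⁻ (λ i → iter g i h) (subst (x ∈_) (cycle≡orbit c) x∈)
       | j , _   , refl ← ∈-applyUpTo⁻ (λ i → iter g i h) (subst (y ∈_) (cycle≡orbit c) y∈)
    = j + (L ∸ i) , (begin
      iter g (j + (L ∸ i)) (iter g i h)       ≡⟨ iter-+ g j (L ∸ i) _ ⟩
      iter g j (iter g (L ∸ i) (iter g i h))  ≡⟨ cong (iter g j) (iter-+ g (L ∸ i) i h) ⟨
      iter g j (iter g (L ∸ i + i) h)         ≡⟨ cong (λ k → iter g j (iter g k h)) (m∸n+n≡m (<⇒≤ i<L)) ⟩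
      iter g j (iter g L h)                   ≡⟨ cong (iter g j) (cycle-period c) ⟩
      iter g j h                              ∎)
    where
    open ≡-Reasoning
    L = suc (length t)

  orbitMinimal-≤ : ∀ {w h y} → IsCycleOf g w → h ∈ w → OrbitMinimal g h → y ∈ w → h ≤ y
  orbitMinimal-≤ c h∈ h-min y∈ with m , refl ← cycle-connected c h∈ y∈ = h-min m

  orbitMinimal-unique : ∀ {w h h′} → IsCycleOf g w → h ∈ w → h′ ∈ w →
                        OrbitMinimal g h → OrbitMinimal g h′ → h ≡ h′
  orbitMinimal-unique c h∈ h′∈ h-min h′-min =
    ≤-antisym (orbitMinimal-≤ c h∈ h-min h′∈) (orbitMinimal-≤ c h′∈ h′-min h∈)

  cycle-head-orbitMinimal : ∀ {h t} → IsCycleOf g (h ∷ t) → (∀ {y} → y ∈ h ∷ t → h ≤ y) → OrbitMinimal g h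
  cycle-head-orbitMinimal c h≤ m = h≤ (cycle-closed c (here refl) m)

  cycle-minimum : ∀ {x t} → IsCycleOf g (x ∷ t) → min x t ∈ x ∷ t × OrbitMinimal g (min x t)
  cycle-minimum {x} {t} c = min∈ , λ k → min≤ (cycle-closed c min∈ k)
    where
    min∈ : min x t ∈ x ∷ t
    min∈ = argmin-all (λ y → y) {P = _∈ x ∷ t} (here refl) (All.tabulate there)
    min≤ : ∀ {y} → y ∈ x ∷ t → min x t ≤ y
    min≤ (here refl) = min≤⊤ x t
    min≤ (there y∈)  = All.lookup (min≤xs x t) y∈

  private
    cycle-length-≤ : ∀ {h t t′} → IsCycleOf g (h ∷ t) → IsCycleOf g (h ∷ t′) → Unique (h ∷ t′) →
                     length t′ ≤ length t
    cycle-length-≤ {h} {t} {t′} c c′ (h∉t′ ∷ _) = ≮⇒≥ λ l<l′ → All.lookup h∉t′ (h∈t′ l<l′) refl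
      where
      h∈t′ : length t < length t′ → h ∈ t′
      h∈t′ l<l′ = subst₂ _∈_ (cycle-period c) (sym (∷-injectiveʳ (cycle≡orbit c′)))
                    (∈-applyUpTo⁺ (λ i → iter g (suc i) h) l<l′)

  cycle-determined : ∀ {h t t′} → IsCycleOf g (h ∷ t) → IsCycleOf g (h ∷ t′) →
                     Unique (h ∷ t) → Unique (h ∷ t′) → t ≡ t′
  cycle-determined {h} {t} {t′} c c′ u u′ = ∷-injectiveʳ (begin
    h ∷ t                         ≡⟨ cycle≡orbit c ⟩
    orbit g h (suc (length t))    ≡⟨ cong (orbit g h ∘ suc) (≤-antisym (cycle-length-≤ c′ c u) (cycle-length-≤ c c′ u′)) ⟩
    orbit g h (suc (length t′))   ≡⟨ cycle≡orbit c′ ⟨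
    h ∷ t′                        ∎)
    where open ≡-Reasoning

-- The cycles of an injective self-map of {1,…,n}

module InjectiveSelfMap {n : ℕ} {g : ℕ → ℕ}
  (g-range : ∀ {x} → InRange n x → InRange n (g x))
  (g-injective : ∀ {x y} → InRange n x → InRange n y → g x ≡ g y → x ≡ y) where

  iter-range : ∀ m {x} → InRange n x → InRange n (iter g m x)
  iter-range zero    x∈ = x∈
  iter-range (suc m) x∈ = g-range (iter-range m x∈)

  iter-cancel : ∀ m {x y} → InRange n x → InRange n y → iter g m x ≡ iter g m y → x ≡ y
  iter-cancel zero    _  _  e = e
  iter-cancel (suc m) x∈ y∈ e = iter-cancel m x∈ y∈ (g-injective (iter-range m x∈) (iter-range m y∈) e)

  return-time : ∀ {x i j p} → InRange n x → i < j → j ≤ p → iter g i x ≡ iter g j x →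
                ∃ λ d → d < p × iter g (suc d) x ≡ x
  return-time {x} {i} {p = p} x∈ i<j j≤p e with d , refl ← m≤n⇒∃[o]m+o≡n i<j =
    d , ≤-trans (s≤s (m≤n+m d i)) j≤p ,
    sym (iter-cancel i x∈ (iter-range (suc d) x∈) (begin
      iter g i x                 ≡⟨ e ⟩
      iter g (suc i + d) x       ≡⟨ cong (λ k → iter g k x) (+-suc i d) ⟨
      iter g (i + suc d) x       ≡⟨ iter-+ g i (suc d) x ⟩
      iter g i (iter g (suc d) x) ∎))
    where open ≡-Reasoning

  orbit-not-unique : ∀ {x} → InRange n x → ¬ Unique (orbit g x (suc n))
  orbit-not-unique {x} x∈ u = 1+n≰n (subst₂ _≤_ (length-applyUpTo (λ i → iter g i x) (suc n)) (length-oneTo n)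
    (unique-⊆⇒length-≤ u (oneTo-unique n) λ y∈ →
      let (i , _ , y≡) = ∈-applyUpTo⁻ (λ i → iter g i x) y∈ in
      ∈-oneTo⁺ (subst (InRange n) (sym y≡) (iter-range i x∈))))

  periodic : ∀ {x} → InRange n x → ∃ λ d → d < n × iter g (suc d) x ≡ x
  periodic {x} x∈
    with i , j , i<j , j<1+n , e ← applyUpTo-collision (λ i → iter g i x) (suc n) (orbit-not-unique x∈) =
    return-time x∈ i<j (≤-pred j<1+n) e

  period : ℕ → ℕ
  period x = leastBelow (λ d → iter g (suc d) x ≟ x) n

  cycleOf : ℕ → List ℕ
  cycleOf x = orbit g x (suc (period x))

  cycleOf-isCycle : ∀ {x} → InRange n x → IsCycleOf g (cycleOf x)
  cycleOf-isCycle {x} x∈ =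
    let (d , d<n , e) = periodic x∈ in orbit-isCycle (leastBelow-satisfies (λ d → iter g (suc d) x ≟ x) d<n e)

  cycleOf-unique : ∀ {x} → InRange n x → Unique (cycleOf x)
  cycleOf-unique {x} x∈ = Unique.applyUpTo⁺₁ _ (suc (period x)) λ i<j j<1+p e →
    let (d , d<p , e′) = return-time x∈ i<j (≤-pred j<1+p) e in
    leastBelow-minimal (λ d → iter g (suc d) x ≟ x) n d<p e′

  cycleOf-range : ∀ {x y} → InRange n x → y ∈ cycleOf x → InRange n y
  cycleOf-range {x} x∈ y∈ with i , _ , refl ← ∈-applyUpTo⁻ (λ i → iter g i x) y∈ = iter-range i x∈

  cycleOf-disjoint : ∀ {h h′ y} → InRange n h → InRange n h′ → OrbitMinimal g h → OrbitMinimal g h′ →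
                     y ∈ cycleOf h → y ∈ cycleOf h′ → h ≡ h′
  cycleOf-disjoint {h} h∈ h′∈ h-min h′-min y∈ y∈′ =
    let (m , e) = cycle-connected (cycleOf-isCycle h′∈) y∈′ (here refl) in
    orbitMinimal-unique (cycleOf-isCycle h∈) (here refl)
      (subst (_∈ cycleOf h) e (cycle-closed (cycleOf-isCycle h∈) y∈ m)) h-min h′-min

  cycleOf-cover : ∀ {x} → InRange n x → ∃ λ h → InRange n h × OrbitMinimal g h × x ∈ cycleOf h
  cycleOf-cover {x} x∈ = cover (cycle-minimum (cycleOf-isCycle x∈))
    where
    cover : ∀ {h} → h ∈ cycleOf x × OrbitMinimal g h → ∃ λ h → InRange n h × OrbitMinimal g h × x ∈ cycleOf h
    cover {h} (h∈ , h-min) =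
      let (m , e) = cycle-connected (cycleOf-isCycle x∈) h∈ (here refl) in
      h , cycleOf-range x∈ h∈ , h-min ,
      subst (_∈ cycleOf h) e (cycle-closed (cycleOf-isCycle (cycleOf-range x∈ h∈)) (here refl) m)

-- Necklaces

≤lex-refl : ∀ w → w ≤lex w
≤lex-refl []      = []≤
≤lex-refl (x ∷ w) = there (≤lex-refl w)

≤lex-head : ∀ {x y xs ys} → (x ∷ xs) ≤lex (y ∷ ys) → x ≤ y
≤lex-head (here x<y) = <⇒≤ x<y
≤lex-head (there _)  = ≤-refl

necklace-head-≤ : ∀ {h t y} → IsNecklace (h ∷ t) → y ∈ h ∷ t → h ≤ y
necklace-head-≤ _ (here refl) = ≤-refl
-- Compare the word with its cyclic shift starting at y.
necklace-head-≤ {h} N (there y∈t) with a , b , refl ← ∈-∃++ y∈t =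
  ≤lex-head (subst (λ s → (h ∷ a ++ _ ∷ b) ≤lex (s ++ take (suc (length a)) (h ∷ a ++ _ ∷ b)))
                   (drop-length-++ a (_ ∷ b))
                   (N (suc (length a)) (s≤s z≤n) (s≤s (subst (length a ≤_) (sym (length-++ a)) (m≤m+n _ _)))))

drop-<-length : ∀ {j} (t : List ℕ) → j < length t → ∃₂ λ y rest → drop j t ≡ y ∷ rest × y ∈ t
drop-<-length {zero}  (x ∷ t) _         = x , t , refl , here refl
drop-<-length {suc j} (x ∷ t) (s≤s j<l) =
  let (y , rest , e , y∈) = drop-<-length t j<l in y , rest , e , there y∈

head-minimal⇒necklace : ∀ {h t} → Unique (h ∷ t) → All (h ≤_) t → IsNecklace (h ∷ t)
head-minimal⇒necklace {h} {t} (h∉t ∷ _) h≤t (suc j) _ (s≤s j≤l) with m≤n⇒m<n∨m≡n j≤l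
... | inj₁ j<l with y , rest , e , y∈ ← drop-<-length t j<l rewrite e =
  here (≤∧≢⇒< (All.lookup h≤t y∈) (All.lookup h∉t y∈))
... | inj₂ refl rewrite drop-all (length t) t ≤-refl | take-all (length t) t ≤-refl = ≤lex-refl (h ∷ t)

∈-firstColumn⁺ : ∀ T {h t} → (h ∷ t) ∈ T → h ∈ firstColumn T
∈-firstColumn⁺ ((h ∷ t) ∷ T) (here refl) = here refl
∈-firstColumn⁺ ([] ∷ T)      (there r∈)  = ∈-firstColumn⁺ T r∈
∈-firstColumn⁺ ((_ ∷ _) ∷ T) (there r∈)  = there (∈-firstColumn⁺ T r∈)

∈-firstColumn⁻ : ∀ T {h} → h ∈ firstColumn T → ∃ λ t → (h ∷ t) ∈ T
∈-firstColumn⁻ ([] ∷ T)      h∈          = let (t , r∈) = ∈-firstColumn⁻ T h∈ in t , there r∈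
∈-firstColumn⁻ ((_ ∷ r) ∷ T) (here refl) = r , here refl
∈-firstColumn⁻ ((_ ∷ _) ∷ T) (there h∈)  = let (t , r∈) = ∈-firstColumn⁻ T h∈ in t , there r∈

length-firstColumn : ∀ T → All (λ r → 1 ≤ length r) T → length (firstColumn T) ≡ length T
length-firstColumn []            _       = refl
length-firstColumn ((_ ∷ _) ∷ T) (_ ∷ p) = cong suc (length-firstColumn T p)

Linked<⇒Unique : ∀ {xs} → Linked _<_ xs → Unique xs
Linked<⇒Unique l = AllPairs.map <⇒≢ (Linked.Linked⇒AllPairs <-trans l)

Linked<-≡ : ∀ {xs ys} → Linked _<_ xs → Linked _<_ ys →
            (∀ {x} → x ∈ xs → x ∈ ys) → (∀ {x} → x ∈ ys → x ∈ xs) → xs ≡ ys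
Linked<-≡ lxs lys xs⊆ys ys⊆xs = Pointwise-≡⇒≡ (↗↭↗⇒≋ ≤-totalOrder
  (Linked.map <⇒≤ lxs) (Linked.map <⇒≤ lys)
  (↭⇒↭ₛ (unique∧set⇒↭ (Linked<⇒Unique lxs) (Linked<⇒Unique lys) xs⊆ys ys⊆xs)))

-- Reading the rows of a tableau as cycles

assoc : List (ℕ × ℕ) → ℕ → ℕ
assoc []             _ = 0
assoc ((a , b) ∷ ps) x with a ≟ x
... | yes _ = b
... | no  _ = assoc ps x

assoc-∈ : ∀ ps {a b} → Unique (map proj₁ ps) → (a , b) ∈ ps → assoc ps a ≡ b
assoc-∈ ((a , b) ∷ ps) _ (here refl) with a ≟ a
... | yes _   = refl
... | no  a≢a = ⊥-elim (a≢a refl)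
assoc-∈ ((a′ , b′) ∷ ps) {a} (a′∉ ∷ u) (there ab∈) with a′ ≟ a
... | yes refl = ⊥-elim (All.lookup a′∉ (∈-map⁺ proj₁ ab∈) refl)
... | no  _    = assoc-∈ ps u ab∈

map-assoc : ∀ ps qs → Unique (map proj₁ ps) → (∀ {q} → q ∈ qs → q ∈ ps) →
            map (assoc ps) (map proj₁ qs) ≡ map proj₂ qs
map-assoc ps []       _ _     = refl
map-assoc ps (q ∷ qs) u qs⊆ps = cong₂ _∷_ (assoc-∈ ps u (qs⊆ps (here refl))) (map-assoc ps qs u (qs⊆ps ∘ there))

rowPairs : List ℕ → List (ℕ × ℕ)
rowPairs r = zip r (rotate r)

successorPairs : List (List ℕ) → List (ℕ × ℕ)
successorPairs T = concat (map rowPairs T)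

successor : List (List ℕ) → ℕ → ℕ
successor T = assoc (successorPairs T)

toPermutation : ℕ → List (List ℕ) → List ℕ
toPermutation n T = map (successor T) (oneTo n)

keys-rowPairs : ∀ r → map proj₁ (rowPairs r) ≡ r
keys-rowPairs r = proj₁ (map-proj-zip r (rotate r) (sym (length-rotate r)))

values-rowPairs : ∀ r → map proj₂ (rowPairs r) ≡ rotate r
values-rowPairs r = proj₂ (map-proj-zip r (rotate r) (sym (length-rotate r)))

keys-successorPairs : ∀ T → map proj₁ (successorPairs T) ≡ concat T
keys-successorPairs []      = refl
keys-successorPairs (r ∷ T) =
  trans (map-++ proj₁ (rowPairs r) (successorPairs T)) (cong₂ _++_ (keys-rowPairs r) (keys-successorPairs T))

map-successor : ∀ {T r} → Unique (concat T) → r ∈ T → map (successor T) r ≡ rotate r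
map-successor {T} {r} u r∈ = begin
  map (successor T) r                         ≡⟨ cong (map (successor T)) (keys-rowPairs r) ⟨
  map (successor T) (map proj₁ (rowPairs r))  ≡⟨ map-assoc (successorPairs T) (rowPairs r)
                                                   (subst Unique (sym (keys-successorPairs T)) u)
                                                   (λ q∈ → ∈-concat⁺′ q∈ (∈-map⁺ rowPairs r∈)) ⟩
  map proj₂ (rowPairs r)                      ≡⟨ values-rowPairs r ⟩
  rotate r                                    ∎
  where open ≡-Reasoning

-- From standard lexical tableaux to permutations

IsCycleRowOf : (ℕ → ℕ) → List ℕ → Set
IsCycleRowOf g r = 1 ≤ length r × Unique r × IsCycleOf g r

cycleRows-determined : ∀ {g T T′} → All (IsCycleRowOf g) T → All (IsCycleRowOf g) T′ →
                       firstColumn T ≡ firstColumn T′ → T ≡ T′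
cycleRows-determined {T = [] ∷ _} ((() , _) ∷ _) _ _
cycleRows-determined {T′ = [] ∷ _} _ ((() , _) ∷ _) _
cycleRows-determined {T = []}          {[]}           _ _ _ = refl
cycleRows-determined {T = []}          {(_ ∷ _) ∷ _} _ _ ()
cycleRows-determined {T = (_ ∷ _) ∷ _} {[]}           _ _ ()
cycleRows-determined {T = (h ∷ t) ∷ T} {(_ ∷ t′) ∷ T′} ((_ , u , c) ∷ rows) ((_ , u′ , c′) ∷ rows′) e
  with refl , e′ ← ∷-injective e =
  cong₂ _∷_ (cong (h ∷_) (cycle-determined c c′ u u′)) (cycleRows-determined rows rows′ e′)

module StdLexTableau {n α T} (std : IsStdLexTableau n α T) (α-positive : All (1 ≤_) α) where

  private
    shape         = proj₁ std
    entries       = proj₁ (proj₂ std)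
    firstColumn<  = proj₁ (proj₂ (proj₂ std))
    necklaces     = proj₂ (proj₂ (proj₂ std))

  σ : List ℕ
  σ = toPermutation n T

  g : ℕ → ℕ
  g = apply σ

  concat-unique : Unique (concat T)
  concat-unique = Unique-resp-↭ (↭-sym entries) (oneTo-unique n)

  rows-nonEmpty : All (λ r → 1 ≤ length r) T
  rows-nonEmpty = All.map⁻ (subst (All (1 ≤_)) (sym shape) α-positive)

  entry-range : ∀ {r x} → r ∈ T → x ∈ r → InRange n x
  entry-range r∈ x∈ = ∈-oneTo⁻ (∈-resp-↭ entries (∈-concat⁺′ x∈ r∈))

  row-head-≤ : ∀ {h t y} → (h ∷ t) ∈ T → y ∈ h ∷ t → h ≤ y
  row-head-≤ r∈ = necklace-head-≤ (All.lookup necklaces r∈)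

  isPermutation : IsPermutation n σ
  isPermutation = begin
    map (successor T) (oneTo n)               ↭⟨ ↭.map⁺ (successor T) (↭-sym entries) ⟩
    map (successor T) (concat T)              ≡⟨ concat-map T ⟨
    concat (map (map (successor T)) T)        ≡⟨ cong concat (map-cong-local (All.tabulate (map-successor {T} concat-unique))) ⟩
    concat (map rotate T)                     ↭⟨ concat-map-rotate-↭ T ⟩
    concat T                                  ↭⟨ entries ⟩
    oneTo n                                   ∎
    where open PermutationReasoning

  row-isCycle : ∀ {r} → r ∈ T → IsCycleOf g r
  row-isCycle r∈ = trans (map-cong-local (All.tabulate λ x∈ → apply-map-oneTo (successor T) (entry-range r∈ x∈)))
                         (map-successor {T} concat-unique r∈)

  rows-isCycleRow : All (IsCycleRowOf g) T
  rows-isCycleRow = All.tabulate λ r∈ →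
    All.lookup rows-nonEmpty r∈ , Unique-concat⁻ T concat-unique r∈ , row-isCycle r∈

  firstColumn⇒cycleMin : ∀ {h} → h ∈ firstColumn T → IsCycleMin n σ h
  firstColumn⇒cycleMin h∈ with t , r∈ ← ∈-firstColumn⁻ T h∈ =
    let (1≤h , h≤n) = entry-range r∈ (here refl) in
    1≤h , h≤n , cycle-head-orbitMinimal (row-isCycle r∈) (row-head-≤ r∈)

  cycleMin⇒firstColumn : ∀ {i} → IsCycleMin n σ i → i ∈ firstColumn T
  cycleMin⇒firstColumn (1≤i , i≤n , i-min)
    with ∈-concat⁻′ T (∈-resp-↭ (↭-sym entries) (∈-oneTo⁺ (1≤i , i≤n)))
  ... | h ∷ t , i∈r , r∈ =
    subst (_∈ firstColumn T)
      (orbitMinimal-unique (row-isCycle r∈) (here refl) i∈r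
        (cycle-head-orbitMinimal (row-isCycle r∈) (row-head-≤ r∈)) i-min)
      (∈-firstColumn⁺ T r∈)

  hasCycles : HasCycles n σ (length α)
  hasCycles = firstColumn T , Linked<⇒Unique firstColumn< ,
              trans (length-firstColumn T rows-nonEmpty) (trans (sym (length-map length T)) (cong length shape)) ,
              λ _ → firstColumn⇒cycleMin , cycleMin⇒firstColumn

toPermutation-injective : ∀ {n α α′ T T′} →
  IsStdLexTableau n α T → All (1 ≤_) α → IsStdLexTableau n α′ T′ → All (1 ≤_) α′ →
  toPermutation n T ≡ toPermutation n T′ → T ≡ T′
toPermutation-injective {n} std pos std′ pos′ e =
  cycleRows-determined S.rows-isCycleRow (subst (λ σ → All (IsCycleRowOf (apply σ)) _) (sym e) S′.rows-isCycleRow)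
    (Linked<-≡ (proj₁ (proj₂ (proj₂ std))) (proj₁ (proj₂ (proj₂ std′)))
      (λ h∈ → S′.cycleMin⇒firstColumn (subst (λ σ → IsCycleMin n σ _) e (S.firstColumn⇒cycleMin h∈)))
      (λ h∈ → S.cycleMin⇒firstColumn (subst (λ σ → IsCycleMin n σ _) (sym e) (S′.firstColumn⇒cycleMin h∈))))
  where
  module S  = StdLexTableau std pos
  module S′ = StdLexTableau std′ pos′

-- From permutations to standard lexical tableaux

module CanonicalTableau {n σ} (perm : IsPermutation n σ) {M : List ℕ} (M-unique : Unique M)
  (M-cycleMins : ∀ x → (x ∈ M → IsCycleMin n σ x) × (IsCycleMin n σ x → x ∈ M)) where

  open InjectiveSelfMap (apply-range perm) (apply-injective perm)

  heads : List ℕ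
  heads = filter (_∈? M) (oneTo n)

  tableau : List (List ℕ)
  tableau = map cycleOf heads

  private
    g = apply σ

    ∈-heads⁻ : ∀ {h} → h ∈ heads → IsCycleMin n σ h
    ∈-heads⁻ {h} h∈ = proj₁ (M-cycleMins h) (proj₂ (∈-filter⁻ (_∈? M) {xs = oneTo n} h∈))

    ∈-heads⁺ : ∀ {h} → IsCycleMin n σ h → h ∈ heads
    ∈-heads⁺ {h} h-min@(1≤h , h≤n , _) = ∈-filter⁺ (_∈? M) (∈-oneTo⁺ (1≤h , h≤n)) (proj₂ (M-cycleMins h) h-min)

    heads-cycleMin : All (IsCycleMin n σ) heads
    heads-cycleMin = All.tabulate ∈-heads⁻

    range : ∀ {h} → IsCycleMin n σ h → InRange n h
    range (1≤h , h≤n , _) = 1≤h , h≤n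

  heads↭M : heads ↭ M
  heads↭M = unique∧set⇒↭ (Unique.filter⁺ (_∈? M) (oneTo-unique n)) M-unique
    (λ h∈ → proj₂ (M-cycleMins _) (∈-heads⁻ h∈)) (λ h∈ → ∈-heads⁺ (proj₁ (M-cycleMins _) h∈))

  firstColumn-tableau : ∀ hs → firstColumn (map cycleOf hs) ≡ hs
  firstColumn-tableau []       = refl
  firstColumn-tableau (h ∷ hs) = cong (h ∷_) (firstColumn-tableau hs)

  concat-unique : Unique (concat tableau)
  concat-unique = Unique.concat⁺
    (All.map⁺ (All.map (cycleOf-unique ∘ range) heads-cycleMin))
    (AllPairs.map⁺ (AllPairs-map-All
      (λ h-min h′-min h≢h′ (y∈ , y∈′) →
        h≢h′ (cycleOf-disjoint (range h-min) (range h′-min) (proj₂ (proj₂ h-min)) (proj₂ (proj₂ h′-min)) y∈ y∈′))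
      heads-cycleMin (Unique.filter⁺ (_∈? M) (oneTo-unique n))))

  ∈-concat⁻ : ∀ {x} → x ∈ concat tableau → InRange n x
  ∈-concat⁻ {x} x∈ =
    let (r , x∈r , r∈) = ∈-concat⁻′ tableau x∈
        (h , h∈ , r≡) = ∈-map⁻ cycleOf r∈
    in cycleOf-range (range (∈-heads⁻ h∈)) (subst (x ∈_) r≡ x∈r)

  ∈-concat⁺ : ∀ {x} → InRange n x → ∃ λ h → h ∈ heads × x ∈ cycleOf h
  ∈-concat⁺ x∈ =
    let (h , (1≤h , h≤n) , h-min , x∈′) = cycleOf-cover x∈ in
    h , ∈-heads⁺ (1≤h , h≤n , h-min) , x∈′

  entries : concat tableau ↭ oneTo n
  entries = unique∧set⇒↭ concat-unique (oneTo-unique n)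
    (∈-oneTo⁺ ∘ ∈-concat⁻)
    (λ x∈ → let (h , h∈ , x∈′) = ∈-concat⁺ (∈-oneTo⁻ x∈) in ∈-concat⁺′ x∈′ (∈-map⁺ cycleOf h∈))

  necklaces : All IsNecklace tableau
  necklaces = All.map⁺ (All.map
    (λ {h} h-min → head-minimal⇒necklace (cycleOf-unique (range h-min))
      (All.tabulate λ y∈ → orbitMinimal-≤ (cycleOf-isCycle (range h-min)) (here refl) (proj₂ (proj₂ h-min)) (there y∈)))
    heads-cycleMin)

  isStdLexTableau : IsStdLexTableau n (map length tableau) tableau
  isStdLexTableau = refl , entries ,
    subst (Linked _<_) (sym (firstColumn-tableau heads))
      (Linked.AllPairs⇒Linked (AllPairs.filter⁺ (_∈? M) (oneTo-strictlyIncreasing n))) ,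
    necklaces

  isComposition : IsComposition n (map length tableau)
  isComposition = All.map⁺ (All.map⁺ (All.tabulate λ _ → s≤s z≤n)) ,
    trans (sym (length-concat tableau)) (trans (↭-length entries) (length-oneTo n))

  length-shape : length (map length tableau) ≡ length M
  length-shape = trans (length-map length tableau) (trans (length-map cycleOf heads) (↭-length heads↭M))

  toPermutation-tableau : toPermutation n tableau ≡ σ
  toPermutation-tableau = begin
    map (successor tableau) (oneTo n)  ≡⟨ map-cong-local (All.tabulate (successor≡g ∘ ∈-oneTo⁻)) ⟩
    map g (oneTo n)                    ≡⟨ cong (λ m → map g (oneTo m)) (length-permutation perm) ⟨
    map g (oneTo (length σ))           ≡⟨ map-apply-oneTo σ ⟩
    σ                                  ∎
    where
    open ≡-Reasoning
    successor≡g : ∀ {x} → InRange n x → successor tableau x ≡ g x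
    successor≡g x∈ =
      let (h , h∈ , x∈′) = ∈-concat⁺ x∈ in
      map-≡⇒≡-∈ (trans (map-successor concat-unique (∈-map⁺ cycleOf h∈))
                       (sym (cycleOf-isCycle (range (∈-heads⁻ h∈))))) x∈′

canonicalTableau : ∀ {n σ k} → IsPermutation n σ → HasCycles n σ k → ∃ λ T →
  (IsComposition n (map length T) × length (map length T) ≡ k) ×
  IsStdLexTableau n (map length T) T × toPermutation n T ≡ σ
canonicalTableau perm (M , M-unique , M-length , M-cycleMins) =
  C.tableau , (C.isComposition , trans C.length-shape M-length) , C.isStdLexTableau , C.toPermutation-tableau
  where module C = CanonicalTableau perm M-unique M-cycleMins

theorem3p3 : (n k : ℕ) → 1 ≤ k → k ≤ n →
    (cs : List (List ℕ)) → Unique cs →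
    (∀ α → (α ∈ cs → IsComposition n α × length α ≡ k)
           × (IsComposition n α × length α ≡ k → α ∈ cs)) →
    (lt : List ℕ → ℕ) →
    (∀ α → α ∈ cs → IsCount (IsStdLexTableau n α) (lt α)) →
    IsCount (λ σ → IsPermutation n σ × HasCycles n σ k) (sum (map lt cs))
theorem3p3 n k _ _ cs cs-unique cs-spec lt lt-count =
  IsCount-image (toPermutation n) injective sound complete
    (IsCount-⋃ {P = IsStdLexTableau n} cs cs-unique shape-unique lt-count)
  where
  Tableau : List (List ℕ) → Set
  Tableau T = ∃ λ α → α ∈ cs × IsStdLexTableau n α T

  positive : ∀ {α} → α ∈ cs → All (1 ≤_) α
  positive α∈ = proj₁ (proj₁ (proj₁ (cs-spec _) α∈))

  shape-unique : ∀ {α β T} → IsStdLexTableau n α T → IsStdLexTableau n β T → α ≡ β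
  shape-unique std std′ = trans (sym (proj₁ std)) (proj₁ std′)

  injective : ∀ {T T′} → Tableau T → Tableau T′ → toPermutation n T ≡ toPermutation n T′ → T ≡ T′
  injective (_ , α∈ , std) (_ , α′∈ , std′) = toPermutation-injective std (positive α∈) std′ (positive α′∈)

  sound : ∀ {T} → Tableau T → IsPermutation n (toPermutation n T) × HasCycles n (toPermutation n T) k
  sound (α , α∈ , std) = S.isPermutation , subst (HasCycles n S.σ) (proj₂ (proj₁ (cs-spec α) α∈)) S.hasCycles
    where module S = StdLexTableau std (positive α∈)

  complete : ∀ {σ} → IsPermutation n σ × HasCycles n σ k → ∃ λ T → Tableau T × toPermutation n T ≡ σ
  complete (perm , cycles) =
    let (T , shape-spec , std , e) = canonicalTableau perm cycles in
    T , (_ , proj₂ (cs-spec _) shape-spec , std) , e
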